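{- Let $\alpha=(\alpha_1,\dots,\alpha_k) \vDash n$. The number of standard lexical tableaux of shape $\alpha$ is \[ K^{\mathfrak{L}}_{\alpha, 1^n} = \frac{n! \prod_{i =1}^{k} (\alpha_i-1)!}{\prod_{c \in \alpha} h_{\alpha}(c)},\] where the product in the denominator runs over all cells $c$ of the diagram of $\alpha$.
   Context: A composition $\alpha \vDash n$ is a tuple of positive integers summing to $n$; its diagram has left-justified rows, row $i$ having $\alpha_i$ cells; cell $c=(i,j)$ is the $j$-th cell of row $i$. The hook $h_\alpha(c)$ of $c=(i,j)$ is $\alpha_i+\alpha_{i+1}+\cdots+\alpha_k$ if $j=1$, and $\alpha_i-j+1$ if $j>1$. A word $w=w_1\cdots w_m$ is a necklace word if it is lexicographically weakly smallest among all its cyclic shifts $w_{i+1}\cdots w_m w_1\cdots w_i$. A standard lexical tableau of shape $\alpha$ is a filling of the diagram with $1,\dots,n$, each used once, such that the first column strictly increases from row $1$ to row $k$ and each row, read left to right, is a necklace word. $K^{\mathfrak{L}}_{\alpha,1^n}$ denotes their number. -}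

module Defs where

open import Data.Nat using (ℕ; zero; suc; _+_; _*_; _∸_; _≤_; _<_)
open import Data.List using (List; []; _∷_; length; map; concat; drop; take; _++_; upTo)
open import Data.Nat.ListAction using (sum; product)
open import Data.List.Relation.Unary.All using (All)
open import Data.List.Relation.Binary.Permutation.Propositional using (_↭_)
open import Data.Product using (_×_)
open import Relation.Binary.PropositionalEquality using (_≡_)

IsComposition : List ℕ → Set
IsComposition α = All (λ a → 1 ≤ a) α

data _≼_ : List ℕ → List ℕ → Set where
  []≼  : ∀ {ys} → [] ≼ ys
  <≼   : ∀ {x y xs ys} → x < y → (x ∷ xs) ≼ (y ∷ ys)
  ≡≼   : ∀ {x xs ys} → xs ≼ ys → (x ∷ xs) ≼ (x ∷ ys)

rotate : ℕ → List ℕ → List ℕ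
rotate i w = drop i w ++ take i w

Necklace : List ℕ → Set
Necklace w = ∀ i → i < length w → w ≼ rotate i w

data StrictlyIncreasing : List ℕ → Set where
  si-[]  : StrictlyIncreasing []
  si-[x] : ∀ {x} → StrictlyIncreasing (x ∷ [])
  si-∷   : ∀ {x y xs} → x < y → StrictlyIncreasing (y ∷ xs) → StrictlyIncreasing (x ∷ y ∷ xs)

firstColumn : List (List ℕ) → List ℕ
firstColumn [] = []
firstColumn ([] ∷ rs) = firstColumn rs
firstColumn ((x ∷ _) ∷ rs) = x ∷ firstColumn rs

-- A filling is given by its rows (row i read left to right).
StandardLexical : List ℕ → List (List ℕ) → Set
StandardLexical α T =
  (map length T ≡ α)
  × (concat T ↭ map suc (upTo (sum α)))
  × StrictlyIncreasing (firstColumn T)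
  × All Necklace T

-- hook of cell (i , j) (1-based), given the suffix  α_i ∷ α_{i+1} ∷ ⋯ ∷ α_k
hookAt : List ℕ → ℕ → ℕ
hookAt [] j = 0
hookAt (a ∷ rest) 1 = sum (a ∷ rest)
hookAt (a ∷ rest) j = a ∸ j + 1

oneTo : ℕ → List ℕ
oneTo m = map suc (upTo m)

hookProduct : List ℕ → ℕ
hookProduct [] = 1
hookProduct (a ∷ rest) = product (map (hookAt (a ∷ rest)) (oneTo a)) * hookProduct rest

-- A row with distinct entries is a necklace exactly when it starts with its smallest entry.
-- Together with the increasing first column this forces the first row to start with the
-- smallest of the n entries, while the remaining α₁ − 1 cells of that row form an arbitrary
-- arrangement of α₁ − 1 of the other n − 1 entries; the rows below form a standard lexical
-- tableau of the remaining shape on the n − α₁ leftover entries. Hence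
--   K(α) = (n − 1)! / (n − α₁)! · K(α₂, …, α_k),
-- and the hooks of the first row contribute n · (α₁ − 1)!, which gives the formula by induction.
module Submission where

open import Defs
open import Data.Nat using (ℕ; zero; suc; _+_; _*_; _∸_; _!; _≤_; _<_; z≤n; s≤s)
open import Data.Nat.Properties
open import Data.Nat.ListAction using (sum; product)
open import Data.Nat.Solver using (module +-*-Solver)
open import Data.List using (List; []; _∷_; [_]; _++_; length; map; concat; concatMap; drop; take; upTo; applyUpTo)
open import Data.List.Properties using (++-identityʳ; length-map; length-++; map-∘; map-applyUpTo; length-upTo; ∷-injectiveˡ; ∷-injectiveʳ)
open import Data.List.Relation.Unary.All as All using (All; []; _∷_)
import Data.List.Relation.Unary.All.Properties as All
open import Data.List.Relation.Unary.Any using (here; there)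
open import Data.List.Relation.Unary.AllPairs as AllPairs using (AllPairs; []; _∷_)
import Data.List.Relation.Unary.AllPairs.Properties as AllPairs
open import Data.List.Relation.Unary.Unique.Propositional using (Unique)
open import Data.List.Membership.Propositional using (_∈_; find; lose)
open import Data.List.Membership.Propositional.Properties using (∈-map⁺; ∈-map⁻; ∈-concatMap⁺; ∈-concatMap⁻)
open import Data.List.Relation.Binary.Permutation.Propositional using (_↭_; ↭-refl; ↭-sym; ↭-trans; prep; swap)
open import Data.List.Relation.Binary.Permutation.Propositional.Properties using (All-resp-↭; ∈-resp-↭; ↭-length; drop-∷; ++⁺ˡ; ¬x∷xs↭[])
open import Data.Product using (∃; ∃₂; _×_; _,_; proj₁; map₁; map₂)
open import Data.Empty using (⊥-elim)
open import Function using (_∘_; _on_)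
open import Function.Bundles using (_⇔_; mk⇔)
open import Relation.Binary.PropositionalEquality using (_≡_; _≢_; refl; sym; trans; cong; cong₂; subst; module ≡-Reasoning)

private
  variable
    A B : Set

length-concatMap-* : (f : A → List B) (xs : List A) {c d : ℕ} →
  (∀ {x} → x ∈ xs → length (f x) * c ≡ d) → length (concatMap f xs) * c ≡ length xs * d
length-concatMap-* f []       _ = refl
length-concatMap-* f (x ∷ xs) {c} {d} each = begin
  length (f x ++ concatMap f xs) * c                    ≡⟨ cong (_* c) (length-++ (f x)) ⟩
  (length (f x) + length (concatMap f xs)) * c          ≡⟨ *-distribʳ-+ c (length (f x)) _ ⟩
  length (f x) * c + length (concatMap f xs) * c        ≡⟨ cong₂ _+_ (each (here refl)) (length-concatMap-* f xs (each ∘ there)) ⟩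
  d + length xs * d                                     ∎
  where open ≡-Reasoning

AllPairs-concatMap⁺ : ∀ {ℓ} {R : A → A → Set ℓ} {f : B → List A} {xs : List B} →
  All (AllPairs R ∘ f) xs → AllPairs (λ x y → All (λ a → All (R a) (f y)) (f x)) xs →
  AllPairs R (concatMap f xs)
AllPairs-concatMap⁺ within across = AllPairs.concat⁺ (All.map⁺ within) (AllPairs.map⁺ across)

All-All-map⁺ : ∀ {ℓ} {R : A → A → Set ℓ} {C D : Set} {f : C → A} {g : D → A} {xs ys} →
  (∀ x y → R (f x) (g y)) → All (λ a → All (R a) (map g ys)) (map f xs)
All-All-map⁺ fRg = All.map⁺ (All.universal (λ x → All.map⁺ (All.universal (fRg x) _)) _)

selections : List A → List (A × List A)
selections []       = []
selections (x ∷ xs) = (x , xs) ∷ map (map₂ (x ∷_)) (selections xs)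

length-selections : (xs : List A) → length (selections xs) ≡ length xs
length-selections []       = refl
length-selections (x ∷ xs) = cong suc (trans (length-map _ (selections xs)) (length-selections xs))

map-proj₁-selections : (xs : List A) → map proj₁ (selections xs) ≡ xs
map-proj₁-selections []       = refl
map-proj₁-selections (x ∷ xs) = cong (x ∷_) (trans (sym (map-∘ (selections xs))) (map-proj₁-selections xs))

selections-↭ : ∀ {xs : List A} {y ys} → (y , ys) ∈ selections xs → xs ↭ y ∷ ys
selections-↭ {xs = x ∷ xs} (here refl) = ↭-refl
selections-↭ {xs = x ∷ xs} (there y∈) with ∈-map⁻ (map₂ (x ∷_)) y∈
... | (y , ys) , y∈′ , refl = ↭-trans (prep x (selections-↭ y∈′)) (swap x y ↭-refl)

∈-selections⁺ : ∀ {xs : List A} {y} → y ∈ xs → ∃ λ ys → (y , ys) ∈ selections xs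
∈-selections⁺ {xs = x ∷ xs} (here refl) = xs , here refl
∈-selections⁺ {xs = x ∷ xs} (there y∈) =
  let ys , y∈′ = ∈-selections⁺ y∈ in x ∷ ys , there (∈-map⁺ (map₂ (x ∷_)) y∈′)

selections-AllPairs : ∀ {ℓ} {R : A → A → Set ℓ} {xs : List A} {y ys} →
  AllPairs R xs → (y , ys) ∈ selections xs → AllPairs R ys
selections-AllPairs {xs = x ∷ xs} (_ ∷ R-xs) (here refl) = R-xs
selections-AllPairs {xs = x ∷ xs} (Rx ∷ R-xs) (there y∈) with ∈-map⁻ (map₂ (x ∷_)) y∈
... | (y , ys) , y∈′ , refl =
  All.tail (All-resp-↭ (selections-↭ y∈′) Rx) ∷ selections-AllPairs R-xs y∈′

-- An arrangement of k elements of xs: an ordered choice of k distinct positions, paired with the leftover list.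

arrangements         : ℕ → List A → List (List A × List A)
prefixedArrangements : ℕ → A × List A → List (List A × List A)

arrangements zero    xs = [ [] , xs ]
arrangements (suc k) xs = concatMap (prefixedArrangements k) (selections xs)

prefixedArrangements k (y , ys) = map (map₁ (y ∷_)) (arrangements k ys)

∈-arrangements-suc⁻ : ∀ k (xs : List A) {p R} → (p , R) ∈ arrangements (suc k) xs →
  ∃₂ λ y ys → ∃ λ p′ → (y , ys) ∈ selections xs × (p′ , R) ∈ arrangements k ys × p ≡ y ∷ p′
∈-arrangements-suc⁻ k xs pR∈ with find (∈-concatMap⁻ (prefixedArrangements k) {xs = selections xs} pR∈)
... | (y , ys) , y∈ , pR∈′ with ∈-map⁻ (map₁ (y ∷_)) pR∈′
... | (p′ , R) , p′R∈ , refl = y , ys , p′ , y∈ , p′R∈ , refl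

arrangements-length : ∀ k {xs : List A} {p R} → (p , R) ∈ arrangements k xs → length p ≡ k
arrangements-length zero    (here refl) = refl
arrangements-length (suc k) {xs} pR∈ with ∈-arrangements-suc⁻ k xs pR∈
... | _ , _ , _ , _ , p′R∈ , refl = cong suc (arrangements-length k p′R∈)

arrangements-↭ : ∀ k {xs : List A} {p R} → (p , R) ∈ arrangements k xs → p ++ R ↭ xs
arrangements-↭ zero    (here refl) = ↭-refl
arrangements-↭ (suc k) {xs} pR∈ with ∈-arrangements-suc⁻ k xs pR∈
... | y , _ , _ , y∈ , p′R∈ , refl = ↭-trans (prep y (arrangements-↭ k p′R∈)) (↭-sym (selections-↭ y∈))

arrangements-AllPairs : ∀ {ℓ} {R : A → A → Set ℓ} k {xs : List A} {p rest} →
  AllPairs R xs → (p , rest) ∈ arrangements k xs → AllPairs R rest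
arrangements-AllPairs zero    R-xs (here refl) = R-xs
arrangements-AllPairs (suc k) {xs} R-xs pR∈ with ∈-arrangements-suc⁻ k xs pR∈
... | _ , _ , _ , y∈ , p′R∈ , refl = arrangements-AllPairs k (selections-AllPairs R-xs y∈) p′R∈

arrangements-length-rest : ∀ k {xs : List A} {p R} → (p , R) ∈ arrangements k xs → k + length R ≡ length xs
arrangements-length-rest k {xs} {p} {R} pR∈ = begin
  k + length R         ≡⟨ cong (_+ length R) (arrangements-length k pR∈) ⟨
  length p + length R  ≡⟨ length-++ p ⟨
  length (p ++ R)      ≡⟨ ↭-length (arrangements-↭ k pR∈) ⟩
  length xs            ∎
  where open ≡-Reasoning

∈-arrangements⁺ : ∀ p {q} {xs : List A} → p ++ q ↭ xs → ∃ λ R → (p , R) ∈ arrangements (length p) xs × q ↭ R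
∈-arrangements⁺ []      {xs = xs} pq↭xs = xs , here refl , pq↭xs
∈-arrangements⁺ (y ∷ p) pq↭xs
  with ys , y∈ ← ∈-selections⁺ (∈-resp-↭ pq↭xs (here refl))
  with R , pR∈ , q↭R ← ∈-arrangements⁺ p (drop-∷ (↭-trans pq↭xs (selections-↭ y∈)))
  = R , ∈-concatMap⁺ (prefixedArrangements (length p)) (lose y∈ (∈-map⁺ (map₁ (y ∷_)) pR∈)) , q↭R

length-arrangements : ∀ k {n} (xs : List A) → length xs ≡ n → k ≤ n →
  length (arrangements k xs) * (n ∸ k) ! ≡ n !
length-arrangements zero    xs       _    _        = +-identityʳ _
length-arrangements (suc k) (x ∷ xs) refl (s≤s k≤) = begin
  length (arrangements (suc k) (x ∷ xs)) * (length xs ∸ k) !  ≡⟨ length-concatMap-* (prefixedArrangements k) (selections (x ∷ xs)) each ⟩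
  length (selections (x ∷ xs)) * (length xs) !                ≡⟨ cong (_* (length xs) !) (length-selections (x ∷ xs)) ⟩
  (length (x ∷ xs)) !                                         ∎
  where
  open ≡-Reasoning
  each : ∀ {q} → q ∈ selections (x ∷ xs) →
    length (prefixedArrangements k q) * (length xs ∸ k) ! ≡ (length xs) !
  each {y , ys} y∈ = trans (cong (_* (length xs ∸ k) !) (length-map (map₁ (y ∷_)) (arrangements k ys)))
    (length-arrangements k ys (sym (suc-injective (↭-length (selections-↭ y∈)))) k≤)

arrangements-distinct : ∀ k {xs : List A} → Unique xs → AllPairs (_≢_ on proj₁) (arrangements k xs)
arrangements-distinct zero    _ = [] ∷ []
arrangements-distinct (suc k) {xs} xs! =
  AllPairs-concatMap⁺ (All.tabulate within) (AllPairs.map across (AllPairs.map⁻ heads!))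
  where
  heads! : Unique (map proj₁ (selections xs))
  heads! = subst Unique (sym (map-proj₁-selections xs)) xs!
  within : ∀ {q} → q ∈ selections xs →
    AllPairs (_≢_ on proj₁) (prefixedArrangements k q)
  within y∈ = AllPairs.map⁺ (AllPairs.map (λ p≢p′ → p≢p′ ∘ ∷-injectiveʳ)
    (arrangements-distinct k (selections-AllPairs xs! y∈)))
  across : ∀ {q q′ : A × List A} → proj₁ q ≢ proj₁ q′ →
    All (λ a → All ((_≢_ on proj₁) a) (prefixedArrangements k q′)) (prefixedArrangements k q)
  across y≢y′ = All-All-map⁺ (λ _ _ → y≢y′ ∘ ∷-injectiveˡ)

-- Necklaces

≼-refl : (w : List ℕ) → w ≼ w
≼-refl []      = []≼
≼-refl (x ∷ w) = ≡≼ (≼-refl w)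

≼-head : ∀ {x y u v} → (x ∷ u) ≼ (y ∷ v) → x ≤ y
≼-head (<≼ x<y) = <⇒≤ x<y
≼-head (≡≼ _)   = ≤-refl

∷≼drop++ : ∀ {x} u {w} j v → All (x <_) w → j < length w → (x ∷ u) ≼ (drop j w ++ v)
∷≼drop++ u zero    v (x<y ∷ _)  _        = <≼ x<y
∷≼drop++ u (suc j) v (_ ∷ x<w) (s≤s j<) = ∷≼drop++ u j v x<w j<

necklace-∷⁺ : ∀ {x w} → All (x <_) w → Necklace (x ∷ w)
necklace-∷⁺ {x} {w} _    zero    _        = subst ((x ∷ w) ≼_) (sym (++-identityʳ (x ∷ w))) (≼-refl (x ∷ w))
necklace-∷⁺ {x} {w} x<w (suc j) (s≤s j<) = ∷≼drop++ w j (x ∷ take j w) x<w j<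

∈⇒drop≡∷ : ∀ {y} {w : List ℕ} → y ∈ w → ∃₂ λ i t → i < length w × drop i w ≡ y ∷ t
∈⇒drop≡∷ {w = _ ∷ w} (here refl) = 0 , w , s≤s z≤n , refl
∈⇒drop≡∷ (there y∈) = let i , t , i< , eq = ∈⇒drop≡∷ y∈ in suc i , t , s≤s i< , eq

necklace-head-≤ : ∀ {x w} → Necklace (x ∷ w) → All (x ≤_) w
necklace-head-≤ {x} {w} nk = All.tabulate λ y∈ →
  let i , t , i< , eq = ∈⇒drop≡∷ y∈
  in ≼-head (subst (λ u → (x ∷ w) ≼ (u ++ x ∷ take i w)) eq (nk (suc i) (s≤s i<)))

StrictlyIncreasing⇒All< : ∀ {x l} → StrictlyIncreasing (x ∷ l) → All (x <_) l
StrictlyIncreasing⇒All< si-[x]         = []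
StrictlyIncreasing⇒All< (si-∷ x<y y∷l) = x<y ∷ All.map (<-trans x<y) (StrictlyIncreasing⇒All< y∷l)

StrictlyIncreasing-tail : ∀ {x l} → StrictlyIncreasing (x ∷ l) → StrictlyIncreasing l
StrictlyIncreasing-tail si-[x]       = si-[]
StrictlyIncreasing-tail (si-∷ _ y∷l) = y∷l

StrictlyIncreasing-∷⁺ : ∀ {x l} → All (x <_) l → StrictlyIncreasing l → StrictlyIncreasing (x ∷ l)
StrictlyIncreasing-∷⁺ _          si-[]        = si-[x]
StrictlyIncreasing-∷⁺ (x<y ∷ _) si-[x]        = si-∷ x<y si-[x]
StrictlyIncreasing-∷⁺ (x<y ∷ _) (si-∷ y<z s) = si-∷ x<y (si-∷ y<z s)

All-firstColumn : ∀ {p} {P : ℕ → Set p} (T : List (List ℕ)) → All P (concat T) → All P (firstColumn T)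
All-firstColumn []            _         = []
All-firstColumn ([] ∷ T)      PT        = All-firstColumn T PT
All-firstColumn ((x ∷ r) ∷ T) (Px ∷ PT) = Px ∷ All-firstColumn T (All.++⁻ʳ r PT)

-- A necklace row starts with its smallest entry.
firstColumn-<-concat : ∀ {x} (T : List (List ℕ)) → All (x <_) (firstColumn T) → All Necklace T → All (x <_) (concat T)
firstColumn-<-concat []            _           _         = []
firstColumn-<-concat ([] ∷ T)      x<T         (_ ∷ nT)  = firstColumn-<-concat T x<T nT
firstColumn-<-concat ((z ∷ r) ∷ T) (x<z ∷ x<T) (nz ∷ nT) =
  x<z ∷ All.++⁺ (All.map (<-≤-trans x<z) (necklace-head-≤ nz)) (firstColumn-<-concat T x<T nT)

first-entry-minimal : ∀ {x p} T → StrictlyIncreasing (x ∷ firstColumn T) → All Necklace ((x ∷ p) ∷ T) →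
  All (x ≤_) (concat ((x ∷ p) ∷ T))
first-entry-minimal T si (nx ∷ nT) =
  ≤-refl ∷ All.++⁺ (necklace-head-≤ nx) (All.map <⇒≤ (firstColumn-<-concat T (StrictlyIncreasing⇒All< si) nT))

-- Lexical tableaux

LexicalTableau : List ℕ → List ℕ → List (List ℕ) → Set
LexicalTableau α S T =
  (map length T ≡ α) × (concat T ↭ S) × StrictlyIncreasing (firstColumn T) × All Necklace T

-- On an increasing list of entries S the first row starts with the head of S.
lexicalTableaux : List ℕ → List ℕ → List (List (List ℕ))
tableauxFromRow : ℕ → List ℕ → List ℕ × List ℕ → List (List (List ℕ))

lexicalTableaux []          []      = [ [] ]
lexicalTableaux (suc k ∷ α) (m ∷ S) = concatMap (tableauxFromRow m α) (arrangements k S)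
lexicalTableaux _           _       = []

tableauxFromRow m α (p , R) = map ((m ∷ p) ∷_) (lexicalTableaux α R)

lexicalTableaux-sound : ∀ α S {T} → AllPairs _<_ S → T ∈ lexicalTableaux α S → LexicalTableau α S T
lexicalTableaux-sound []          []      _           (here refl) = refl , ↭-refl , si-[] , []
lexicalTableaux-sound (suc k ∷ α) (m ∷ S) (m<S ∷ S↑) T∈
  with (p , R) , pR∈ , T∈′ ← find (∈-concatMap⁻ (tableauxFromRow m α) {xs = arrangements k S} T∈)
  with T , T∈ , refl ← ∈-map⁻ ((m ∷ p) ∷_) T∈′
  with shape , T↭R , si , nT ← lexicalTableaux-sound α R (arrangements-AllPairs k S↑ pR∈) T∈
  = cong₂ _∷_ (cong suc (arrangements-length k pR∈)) shape ,
    prep m pT↭S ,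
    StrictlyIncreasing-∷⁺ (All-firstColumn T m<T) si ,
    necklace-∷⁺ m<p ∷ nT
  where
  pT↭S : p ++ concat T ↭ S
  pT↭S = ↭-trans (++⁺ˡ p T↭R) (arrangements-↭ k pR∈)
  m<pT : All (m <_) (p ++ concat T)
  m<pT = All-resp-↭ (↭-sym pT↭S) m<S
  m<p : All (m <_) p
  m<p = All.++⁻ˡ p m<pT
  m<T : All (m <_) (concat T)
  m<T = All.++⁻ʳ p m<pT

first-entry≡least : ∀ {x p m S} {T : List (List ℕ)} → All (m <_) S → concat ((x ∷ p) ∷ T) ↭ m ∷ S →
  StrictlyIncreasing (x ∷ firstColumn T) → All Necklace ((x ∷ p) ∷ T) → x ≡ m
first-entry≡least {T = T} m<S T↭S si nT = ≤-antisym
  (All.lookup (first-entry-minimal T si nT) (∈-resp-↭ (↭-sym T↭S) (here refl)))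
  (All.lookup (≤-refl ∷ All.map <⇒≤ m<S) (∈-resp-↭ T↭S (here refl)))

lexicalTableaux-complete : ∀ α S {T} → IsComposition α → AllPairs _<_ S → LexicalTableau α S T →
  T ∈ lexicalTableaux α S
lexicalTableaux-complete []      []      {[]}    _ _ _                 = here refl
lexicalTableaux-complete []      (_ ∷ _) {[]}    _ _ (_ , T↭S , _)     = ⊥-elim (¬x∷xs↭[] (↭-sym T↭S))
lexicalTableaux-complete []      _       {_ ∷ _} _ _ (() , _)
lexicalTableaux-complete (_ ∷ _) _       {[]}    _ _ (() , _)
lexicalTableaux-complete (zero ∷ _) _ (() ∷ _) _ _
lexicalTableaux-complete (suc k ∷ α) S   {[] ∷ T} _ _ (() , _)
lexicalTableaux-complete (suc k ∷ α) [] {(x ∷ p) ∷ T} _ _ (_ , T↭[] , _) = ⊥-elim (¬x∷xs↭[] T↭[])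
lexicalTableaux-complete (suc .(length p) ∷ .(map length T)) (m ∷ S) {(x ∷ p) ∷ T}
                         (_ ∷ α-comp) (m<S ∷ S↑) (refl , T↭S , si , nT)
  with refl ← first-entry≡least m<S T↭S si nT
  with R , pR∈ , T↭R ← ∈-arrangements⁺ p (drop-∷ T↭S)
  = ∈-concatMap⁺ (tableauxFromRow m (map length T)) (lose pR∈ (∈-map⁺ ((m ∷ p) ∷_) T∈))
  where
  T∈ : T ∈ lexicalTableaux (map length T) R
  T∈ = lexicalTableaux-complete (map length T) R α-comp (arrangements-AllPairs (length p) S↑ pR∈)
         (refl , T↭R , StrictlyIncreasing-tail si , All.tail nT)

lexicalTableaux-unique : ∀ α {S} → Unique S → Unique (lexicalTableaux α S)
lexicalTableaux-unique []          {[]}    _          = [] ∷ []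
lexicalTableaux-unique []          {_ ∷ _} _          = []
lexicalTableaux-unique (zero ∷ α)  {_}     _          = []
lexicalTableaux-unique (suc k ∷ α) {[]}    _          = []
lexicalTableaux-unique (suc k ∷ α) {m ∷ S} (_ ∷ S!) =
  AllPairs-concatMap⁺ (All.tabulate within) (AllPairs.map across (arrangements-distinct k S!))
  where
  within : ∀ {q} → q ∈ arrangements k S → Unique (tableauxFromRow m α q)
  within pR∈ = AllPairs.map⁺ (AllPairs.map (λ T≢T′ → T≢T′ ∘ ∷-injectiveʳ)
    (lexicalTableaux-unique α (arrangements-AllPairs k S! pR∈)))
  across : ∀ {q q′ : List ℕ × List ℕ} → proj₁ q ≢ proj₁ q′ →
    All (λ T → All (T ≢_) (tableauxFromRow m α q′)) (tableauxFromRow m α q)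
  across p≢p′ = All-All-map⁺ (λ _ _ → p≢p′ ∘ ∷-injectiveʳ ∘ ∷-injectiveˡ)

-- Hooks and the counting formula

product-countdown : ∀ n → product (applyUpTo (λ i → n ∸ suc i + 1) n) ≡ n !
product-countdown zero    = refl
product-countdown (suc n) = cong₂ _*_ (+-comm n 1) (product-countdown n)

-- The first cell of the row has hook n; the others have hooks α₁ − 1, …, 1.
product-firstRowHooks : ∀ k α → product (map (hookAt (suc k ∷ α)) (oneTo (suc k))) ≡ sum (suc k ∷ α) * k !
product-firstRowHooks k α = cong (sum (suc k ∷ α) *_) (begin
  product (map h (map suc (applyUpTo suc k)))  ≡⟨ cong (product ∘ map h) (map-applyUpTo suc suc k) ⟩
  product (map h (applyUpTo (suc ∘ suc) k))    ≡⟨ cong product (map-applyUpTo (suc ∘ suc) h k) ⟩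
  product (applyUpTo (h ∘ suc ∘ suc) k)        ≡⟨ product-countdown k ⟩
  k !                                          ∎)
  where
  open ≡-Reasoning
  h : ℕ → ℕ
  h = hookAt (suc k ∷ α)

rowFactorials : List ℕ → ℕ
rowFactorials α = product (map (λ a → (a ∸ 1) !) α)

length-lexicalTableaux : ∀ α S → IsComposition α → length S ≡ sum α →
  length (lexicalTableaux α S) * hookProduct α ≡ (sum α) ! * rowFactorials α
length-lexicalTableaux []          []      _            _     = refl
length-lexicalTableaux (zero ∷ α)  _       (() ∷ _)     _
length-lexicalTableaux (suc k ∷ α) (m ∷ S) (_ ∷ α-comp) |mS|≡ = begin
  length L * (product (map (hookAt (suc k ∷ α)) (oneTo (suc k))) * H)
    ≡⟨ cong (λ h → length L * (h * H)) (product-firstRowHooks k α) ⟩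
  length L * (suc n * k ! * H)
    ≡⟨ solve 4 (λ l a b h → l :* (a :* b :* h) := a :* b :* (l :* h)) refl (length L) (suc n) (k !) H ⟩
  suc n * k ! * (length L * H)
    ≡⟨ cong (suc n * k ! *_) blocks ⟩
  suc n * k ! * (length Arr * (N ! * P))
    ≡⟨ solve 5 (λ a b l f p → a :* b :* (l :* (f :* p)) := a :* (l :* f) :* (b :* p)) refl (suc n) (k !) (length Arr) (N !) P ⟩
  suc n * (length Arr * N !) * (k ! * P)
    ≡⟨ cong (λ z → suc n * z * (k ! * P)) arrangements-count ⟩
  suc n * n ! * (k ! * P)
    ∎
  where
  open ≡-Reasoning
  open +-*-Solver
  N n H P : ℕ
  N = sum α
  n = k + N
  H = hookProduct α
  P = rowFactorials α
  Arr : List (List ℕ × List ℕ)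
  Arr = arrangements k S
  L : List (List (List ℕ))
  L = lexicalTableaux (suc k ∷ α) (m ∷ S)
  |S|≡n : length S ≡ n
  |S|≡n = suc-injective |mS|≡
  arrangements-count : length Arr * N ! ≡ n !
  arrangements-count = subst (λ d → length Arr * d ! ≡ n !) (m+n∸m≡n k N)
    (length-arrangements k S |S|≡n (m≤m+n k N))
  blocks : length L * H ≡ length Arr * (N ! * P)
  blocks = length-concatMap-* (tableauxFromRow m α) Arr λ {(p , R)} pR∈ →
    trans (cong (_* H) (length-map ((m ∷ p) ∷_) (lexicalTableaux α R)))
          (length-lexicalTableaux α R α-comp (+-cancelˡ-≡ k _ _ (trans (arrangements-length-rest k pR∈) |S|≡n)))

oneTo-increasing : ∀ n → AllPairs _<_ (oneTo n)
oneTo-increasing n = AllPairs.map⁺ (AllPairs.applyUpTo⁺₁ (λ i → i) n (λ i<j _ → s≤s i<j))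

length-oneTo : ∀ n → length (oneTo n) ≡ n
length-oneTo n = trans (length-map suc (upTo n)) (length-upTo n)

theorem3p7 : (α : List ℕ) → IsComposition α →
    ∃ λ (L : List (List (List ℕ))) →
      Unique L
      × (∀ T → (T ∈ L) ⇔ StandardLexical α T)
      × (length L * hookProduct α ≡ (sum α) ! * product (map (λ a → (a ∸ 1) !) α))
theorem3p7 α α-comp =
  lexicalTableaux α S ,
  lexicalTableaux-unique α (AllPairs.map <⇒≢ S↑) ,
  (λ T → mk⇔ (lexicalTableaux-sound α S S↑) (lexicalTableaux-complete α S α-comp S↑)) ,
  length-lexicalTableaux α S α-comp (length-oneTo (sum α))
  where
  S : List ℕ
  S = oneTo (sum α)
  S↑ : AllPairs _<_ S
  S↑ = oneTo-increasing (sum α)
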